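{- Let $a_0,a_1,a_2,\ldots$ be a sequence of complex numbers, and for $l=0,1,2,\ldots$ set $A_l(t)=\sum_{k=0}^l\binom lk(-1)^ka_kt^{l-k}$. Then for any $m,n\in\mathbb{N}=\{0,1,2,\ldots\}$ and complex numbers $x,y$, $$\sum_{k=0}^n\binom nk\frac{x^{m+k+1}}{m+k+1}A_{n-k}(y)+(-1)^m\frac{A_{m+n+1}(y)}{(m+n+1)\binom{m+n}n} =\sum_{k=0}^m\frac{\binom mk}{\binom{n+k}k}(-1)^kx^{m-k}\frac{A_{n+k+1}(x+y)}{n+k+1}.$$ -}

module Defs where

open import Level using (Level; suc; _⊔_)
open import Algebra.Bundles using (CommutativeRing)
open import Data.Nat as ℕ using (ℕ; zero; _∸_)
open import Data.Nat.Combinatorics using (_C_)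

fromℕ : {c ℓ : Level} (R : CommutativeRing c ℓ) → ℕ → CommutativeRing.Carrier R
fromℕ R zero = CommutativeRing.0# R
fromℕ R (ℕ.suc n) = CommutativeRing._+_ R (CommutativeRing.1# R) (fromℕ R n)

-- A ℚ-algebra: a commutative ring in which every positive integer is
-- invertible (e.g. ℂ).  inv n is the inverse of the integer n + 1.
record QAlgebra (c ℓ : Level) : Set (suc (c ⊔ ℓ)) where
  field
    cring : CommutativeRing c ℓ
  open CommutativeRing cring public
  field
    inv         : ℕ → Carrier
    inv-correct : ∀ n → fromℕ cring (ℕ.suc n) * inv n ≈ 1#

module Ops {c ℓ : Level} (R : QAlgebra c ℓ) where
  open QAlgebra R

  ⟦_⟧ : ℕ → Carrier
  ⟦ n ⟧ = fromℕ cring n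

  pow : Carrier → ℕ → Carrier
  pow x zero = 1#
  pow x (ℕ.suc n) = x * pow x n

  sgn : ℕ → Carrier
  sgn k = pow (- 1#) k

  -- division by a natural number; only used with nonzero denominators
  -- (division by 0 is given the junk value 0#)
  _/ℕ_ : Carrier → ℕ → Carrier
  x /ℕ zero = 0#
  x /ℕ ℕ.suc d = x * inv d

  Σ≤ : ℕ → (ℕ → Carrier) → Carrier
  Σ≤ zero f = f 0
  Σ≤ (ℕ.suc n) f = Σ≤ n f + f (ℕ.suc n)

  A : (ℕ → Carrier) → ℕ → Carrier → Carrier
  A a l t = Σ≤ l (λ k → ⟦ l C k ⟧ * sgn k * a k * pow t (l ∸ k))

{-# OPTIONS --safe #-}
-- Each side H(m, n) of the identity satisfies
--   (n+1) H(0, n) = A_{n+1}(x+y),   (n+1) H(m+1, n) + (m+1) H(m, n+1) = x^{m+1} A_{n+1}(x+y),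
-- which determines H because every n + 1 is invertible. On the right, the absorption identities
-- for binomial coefficients make the (k+1)-st summand of (n+1) H(m+1, n) and the k-th summand of
-- (m+1) H(m, n+1) opposite, so only the k = 0 term survives. On the left, the boundary term
-- (-1)^m A_{m+n+1}(y)/((m+n+1) C(m+n,n)) satisfies the homogeneous recurrence with initial values
-- A_{n+1}(y), and the sum the displayed one with initial values A_{n+1}(x+y) - A_{n+1}(y); the
-- latter is the Appell property A_l(x+y) = Σ_j C(l,j) x^j A_{l-j}(y), which follows by induction
-- on l from A_{l+1}(t) + A'_l(t) = t A_l(t), where A' is built from the shifted sequence a_{k+1}.
module Submission where

open import Defs
open import Level using (Level)
open import Data.Nat as ℕ using (ℕ; zero; suc; _∸_; _≤_; s≤s; NonZero; >-nonZero; >-nonZero⁻¹)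
import Data.Nat.Properties as ℕₚ
open import Algebra.Properties.CommutativeSemigroup ℕₚ.*-commutativeSemigroup
  using () renaming (x∙yz≈y∙xz to ℕ-x∙yz≈y∙xz; xy∙z≈y∙xz to ℕ-xy∙z≈y∙xz)
open import Data.Nat.Combinatorics using (_C_; nCk+nC[k+1]≡[n+1]C[k+1]; nC1≡n; nCn≡1; k>n⇒nCk≡0)
open import Relation.Binary.PropositionalEquality as ≡ using (_≡_)

module _ where
  open import Data.Nat using (_+_; _*_)
  open ≡ using (cong; cong₂)
  open ≡.≡-Reasoning

  [1+k]*[1+n]C[1+k]≡[1+n]*nCk : ∀ n k → suc k * (suc n C suc k) ≡ suc n * (n C k)
  [1+k]*[1+n]C[1+k]≡[1+n]*nCk n zero =
    ≡.trans (ℕₚ.*-identityˡ _) (≡.trans (nC1≡n (suc n)) (≡.sym (ℕₚ.*-identityʳ _)))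
  [1+k]*[1+n]C[1+k]≡[1+n]*nCk zero (suc k) = ℕₚ.*-zeroʳ (suc (suc k))
  [1+k]*[1+n]C[1+k]≡[1+n]*nCk (suc n) (suc k) = begin
    suc (suc k) * (suc (suc n) C suc (suc k))
      ≡⟨ cong (suc (suc k) *_) (nCk+nC[k+1]≡[n+1]C[k+1] (suc n) (suc k)) ⟨
    suc (suc k) * (c + c′)
      ≡⟨ ℕₚ.*-distribˡ-+ (suc (suc k)) c c′ ⟩
    c + suc k * c + suc (suc k) * c′
      ≡⟨ cong₂ (λ u v → c + u + v) ([1+k]*[1+n]C[1+k]≡[1+n]*nCk n k)
                                   ([1+k]*[1+n]C[1+k]≡[1+n]*nCk n (suc k)) ⟩
    c + suc n * (n C k) + suc n * (n C suc k)
      ≡⟨ ℕₚ.+-assoc c _ _ ⟩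
    c + (suc n * (n C k) + suc n * (n C suc k))
      ≡⟨ cong (c +_) (ℕₚ.*-distribˡ-+ (suc n) (n C k) (n C suc k)) ⟨
    c + suc n * (n C k + n C suc k)
      ≡⟨ cong (λ u → c + suc n * u) (nCk+nC[k+1]≡[n+1]C[k+1] n k) ⟩
    c + suc n * c
      ∎
    where
    c = suc n C suc k
    c′ = suc n C suc (suc k)

  [1+k]*[1+p+k]C[1+k]≡[1+p]*[1+p+k]Ck :
    ∀ p k → suc k * (suc (p + k) C suc k) ≡ suc p * (suc (p + k) C k)
  [1+k]*[1+p+k]C[1+k]≡[1+p]*[1+p+k]Ck p k = ℕₚ.+-cancelˡ-≡ (suc k * a) _ _ (begin
    suc k * a + suc k * b    ≡⟨ ℕₚ.*-distribˡ-+ (suc k) a b ⟨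
    suc k * (a + b)          ≡⟨ cong (suc k *_) (nCk+nC[k+1]≡[n+1]C[k+1] N k) ⟩
    suc k * (suc N C suc k)  ≡⟨ [1+k]*[1+n]C[1+k]≡[1+n]*nCk N k ⟩
    suc N * a                ≡⟨ cong (λ i → suc i * a) (ℕₚ.+-suc p k) ⟨
    (suc p + suc k) * a      ≡⟨ ℕₚ.*-distribʳ-+ a (suc p) (suc k) ⟩
    suc p * a + suc k * a    ≡⟨ ℕₚ.+-comm (suc p * a) _ ⟩
    suc k * a + suc p * a    ∎)
    where
    N = suc (p + k)
    a = N C k
    b = N C suc k

  n+0+1≡1+n : ∀ n → n + 0 + 1 ≡ suc n
  n+0+1≡1+n n = ≡.trans (ℕₚ.+-comm (n + 0) 1) (cong suc (ℕₚ.+-identityʳ n))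

  nCk≢0 : ∀ {n k} → k ≤ n → NonZero (n C k)
  nCk≢0 {k = zero} _ = _
  nCk≢0 {suc n} {suc k} (s≤s k≤n) = ≡.subst NonZero (nCk+nC[k+1]≡[n+1]C[k+1] n k)
    (>-nonZero (ℕₚ.<-≤-trans (>-nonZero⁻¹ (n C k) {{nCk≢0 k≤n}}) (ℕₚ.m≤m+n _ _)))

module _ {ℓ₁ ℓ₂ : Level} (Q : QAlgebra ℓ₁ ℓ₂) where
  open QAlgebra Q
  open Ops Q
  open import Algebra.Properties.Ring ring using (-1*x≈-x; -‿distribˡ-*; +-cancelʳ)
  open import Algebra.Properties.Semiring.Mult semiring using (_×_; ×-homo-+; ×1-homo-*)
  open import Algebra.Properties.CommutativeSemigroup *-commutativeSemigroup
    using (x∙yz≈y∙xz; xy∙z≈y∙xz)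
  open import Algebra.Properties.CommutativeSemigroup +-commutativeSemigroup
    using () renaming (interchange to +-interchange; x∙yz≈y∙xz to x+[y+z]≈y+[x+z])
  open import Algebra.Solver.Ring.NaturalCoefficients.Default commutativeSemiring
    using (solve; _:=_; _:+_; _:*_)
  open import Relation.Binary.Reasoning.Setoid setoid

  ⟦⟧≈×1# : ∀ n → ⟦ n ⟧ ≈ n × 1#
  ⟦⟧≈×1# zero = refl
  ⟦⟧≈×1# (suc n) = +-congˡ (⟦⟧≈×1# n)

  ⟦⟧-homo-+ : ∀ m n → ⟦ m ℕ.+ n ⟧ ≈ ⟦ m ⟧ + ⟦ n ⟧
  ⟦⟧-homo-+ m n = begin
    ⟦ m ℕ.+ n ⟧          ≈⟨ ⟦⟧≈×1# (m ℕ.+ n) ⟩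
    (m ℕ.+ n) × 1#       ≈⟨ ×-homo-+ 1# m n ⟩
    m × 1# + n × 1#      ≈⟨ +-cong (⟦⟧≈×1# m) (⟦⟧≈×1# n) ⟨
    ⟦ m ⟧ + ⟦ n ⟧        ∎

  ⟦⟧-homo-* : ∀ m n → ⟦ m ℕ.* n ⟧ ≈ ⟦ m ⟧ * ⟦ n ⟧
  ⟦⟧-homo-* m n = begin
    ⟦ m ℕ.* n ⟧          ≈⟨ ⟦⟧≈×1# (m ℕ.* n) ⟩
    (m ℕ.* n) × 1#       ≈⟨ ×1-homo-* m n ⟩
    (m × 1#) * (n × 1#)  ≈⟨ *-cong (⟦⟧≈×1# m) (⟦⟧≈×1# n) ⟨
    ⟦ m ⟧ * ⟦ n ⟧        ∎

  ⟦1⟧≈1# : ⟦ 1 ⟧ ≈ 1#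
  ⟦1⟧≈1# = +-identityʳ 1#

  pow-+ : ∀ t i j → pow t (i ℕ.+ j) ≈ pow t i * pow t j
  pow-+ t zero j = sym (*-identityˡ _)
  pow-+ t (suc i) j = trans (*-congˡ (pow-+ t i j)) (sym (*-assoc _ _ _))

  ⟦q⟧*[x/q]≈x : ∀ q .{{_ : NonZero q}} X → ⟦ q ⟧ * (X /ℕ q) ≈ X
  ⟦q⟧*[x/q]≈x (suc d) X = begin
    ⟦ suc d ⟧ * (X * inv d)  ≈⟨ x∙yz≈y∙xz _ _ _ ⟩
    X * (⟦ suc d ⟧ * inv d)  ≈⟨ *-congˡ (inv-correct d) ⟩
    X * 1#                   ≈⟨ *-identityʳ X ⟩
    X                        ∎

  ⟦q*p⟧*[x/q]≈⟦p⟧*x : ∀ q p .{{_ : NonZero q}} X → ⟦ q ℕ.* p ⟧ * (X /ℕ q) ≈ ⟦ p ⟧ * X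
  ⟦q*p⟧*[x/q]≈⟦p⟧*x q p X = begin
    ⟦ q ℕ.* p ⟧ * (X /ℕ q)     ≈⟨ *-congʳ (trans (⟦⟧-homo-* q p) (*-comm _ _)) ⟩
    (⟦ p ⟧ * ⟦ q ⟧) * (X /ℕ q) ≈⟨ *-assoc _ _ _ ⟩
    ⟦ p ⟧ * (⟦ q ⟧ * (X /ℕ q)) ≈⟨ *-congˡ (⟦q⟧*[x/q]≈x q X) ⟩
    ⟦ p ⟧ * X                  ∎

  [⟦q⟧*x]/q≈x : ∀ q .{{_ : NonZero q}} X → (⟦ q ⟧ * X) /ℕ q ≈ X
  [⟦q⟧*x]/q≈x (suc d) X = trans (xy∙z≈y∙xz _ _ _) (trans (*-congˡ (inv-correct d)) (*-identityʳ X))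

  /ℕ-congˡ : ∀ q {X Y} → X ≈ Y → X /ℕ q ≈ Y /ℕ q
  /ℕ-congˡ zero _ = refl
  /ℕ-congˡ (suc d) X≈Y = *-congʳ X≈Y

  ⟦q⟧*-cancelˡ : ∀ q .{{_ : NonZero q}} {u v} → ⟦ q ⟧ * u ≈ ⟦ q ⟧ * v → u ≈ v
  ⟦q⟧*-cancelˡ q {u} {v} qu≈qv = begin
    u                 ≈⟨ [⟦q⟧*x]/q≈x q u ⟨
    (⟦ q ⟧ * u) /ℕ q  ≈⟨ /ℕ-congˡ q qu≈qv ⟩
    (⟦ q ⟧ * v) /ℕ q  ≈⟨ [⟦q⟧*x]/q≈x q v ⟩
    v                 ∎

  ⟦p⟧*[x/q]≈⟦p′⟧*[x/q′] : ∀ p q p′ q′ .{{_ : NonZero q}} .{{_ : NonZero q′}} X →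
                          p ℕ.* q′ ≡ p′ ℕ.* q → ⟦ p ⟧ * (X /ℕ q) ≈ ⟦ p′ ⟧ * (X /ℕ q′)
  ⟦p⟧*[x/q]≈⟦p′⟧*[x/q′] p q p′ q′ X pq′≡p′q =
    ⟦q⟧*-cancelˡ (q ℕ.* q′) {{ℕₚ.m*n≢0 q q′}} (begin
    ⟦ q ℕ.* q′ ⟧ * (⟦ p ⟧ * (X /ℕ q))      ≈⟨ *-congʳ (⟦⟧-homo-* q q′) ⟩
    (⟦ q ⟧ * ⟦ q′ ⟧) * (⟦ p ⟧ * (X /ℕ q))  ≈⟨ swap _ _ _ _ ⟩
    (⟦ p ⟧ * ⟦ q′ ⟧) * (⟦ q ⟧ * (X /ℕ q))
      ≈⟨ *-cong (sym (⟦⟧-homo-* p q′)) (⟦q⟧*[x/q]≈x q X) ⟩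
    ⟦ p ℕ.* q′ ⟧ * X                        ≡⟨ ≡.cong (λ i → ⟦ i ⟧ * X) pq′≡p′q ⟩
    ⟦ p′ ℕ.* q ⟧ * X
      ≈⟨ *-cong (⟦⟧-homo-* p′ q) (sym (⟦q⟧*[x/q]≈x q′ X)) ⟩
    (⟦ p′ ⟧ * ⟦ q ⟧) * (⟦ q′ ⟧ * (X /ℕ q′)) ≈⟨ swap _ _ _ _ ⟨
    (⟦ q′ ⟧ * ⟦ q ⟧) * (⟦ p′ ⟧ * (X /ℕ q′)) ≈⟨ *-congʳ (*-comm _ _) ⟩
    (⟦ q ⟧ * ⟦ q′ ⟧) * (⟦ p′ ⟧ * (X /ℕ q′)) ≈⟨ *-congʳ (⟦⟧-homo-* q q′) ⟨
    ⟦ q ℕ.* q′ ⟧ * (⟦ p′ ⟧ * (X /ℕ q′))    ∎)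
    where
    swap : ∀ a b c d → (a * b) * (c * d) ≈ (c * b) * (a * d)
    swap = solve 4 (λ a b c d → (a :* b) :* (c :* d) := (c :* b) :* (a :* d)) refl

  x/q≈x*[1/q] : ∀ q X → X /ℕ q ≈ X * (1# /ℕ q)
  x/q≈x*[1/q] zero X = sym (zeroʳ X)
  x/q≈x*[1/q] (suc d) X = *-congˡ (sym (*-identityˡ (inv d)))

  Σ≤-cong : ∀ n {f g : ℕ → Carrier} → (∀ k → k ≤ n → f k ≈ g k) → Σ≤ n f ≈ Σ≤ n g
  Σ≤-cong zero f≈g = f≈g 0 ℕ.z≤n
  Σ≤-cong (suc n) f≈g =
    +-cong (Σ≤-cong n (λ k k≤n → f≈g k (ℕₚ.m≤n⇒m≤1+n k≤n))) (f≈g (suc n) ℕₚ.≤-refl)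

  Σ≤-+ : ∀ n (f g : ℕ → Carrier) → Σ≤ n (λ k → f k + g k) ≈ Σ≤ n f + Σ≤ n g
  Σ≤-+ zero f g = refl
  Σ≤-+ (suc n) f g = trans (+-congʳ (Σ≤-+ n f g)) (+-interchange _ _ _ _)

  Σ≤-*ˡ : ∀ n u (f : ℕ → Carrier) → u * Σ≤ n f ≈ Σ≤ n (λ k → u * f k)
  Σ≤-*ˡ zero u f = refl
  Σ≤-*ˡ (suc n) u f = trans (distribˡ _ _ _) (+-congʳ (Σ≤-*ˡ n u f))

  Σ≤-lincomb : ∀ n u v (f g : ℕ → Carrier) →
               u * Σ≤ n f + v * Σ≤ n g ≈ Σ≤ n (λ k → u * f k + v * g k)
  Σ≤-lincomb n u v f g = trans (+-cong (Σ≤-*ˡ n u f) (Σ≤-*ˡ n v g)) (sym (Σ≤-+ n _ _))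

  Σ≤-≈0 : ∀ n {f : ℕ → Carrier} → (∀ k → f k ≈ 0#) → Σ≤ n f ≈ 0#
  Σ≤-≈0 zero f≈0 = f≈0 0
  Σ≤-≈0 (suc n) f≈0 = trans (+-cong (Σ≤-≈0 n f≈0) (f≈0 (suc n))) (+-identityʳ 0#)

  Σ≤-suc : ∀ n (f : ℕ → Carrier) → Σ≤ (suc n) f ≈ f 0 + Σ≤ n (λ k → f (suc k))
  Σ≤-suc zero f = refl
  Σ≤-suc (suc n) f = trans (+-congʳ (Σ≤-suc n f)) (+-assoc _ _ _)

  binomial-sum-peel : ∀ l (g : ℕ → Carrier) →
    Σ≤ l (λ j → ⟦ l C j ⟧ * g j) ≈ ⟦ l C 0 ⟧ * g 0 + Σ≤ l (λ j → ⟦ l C suc j ⟧ * g (suc j))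
  binomial-sum-peel zero g = sym (trans (+-congˡ (zeroˡ _)) (+-identityʳ _))
  binomial-sum-peel (suc l) g = trans (Σ≤-suc l _) (+-congˡ (sym (trans (+-congˡ last≈0) (+-identityʳ _))))
    where
    last≈0 : ⟦ suc l C suc (suc l) ⟧ * g (suc (suc l)) ≈ 0#
    last≈0 = trans (*-congʳ (reflexive (≡.cong ⟦_⟧ (k>n⇒nCk≡0 (ℕₚ.n<1+n (suc l)))))) (zeroˡ _)

  binomial-sum-pascal : ∀ l (g : ℕ → Carrier) →
    Σ≤ (suc l) (λ j → ⟦ suc l C j ⟧ * g j)
      ≈ Σ≤ l (λ j → ⟦ l C j ⟧ * g j) + Σ≤ l (λ j → ⟦ l C j ⟧ * g (suc j))
  binomial-sum-pascal l g = begin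
    Σ≤ (suc l) (λ j → ⟦ suc l C j ⟧ * g j)
      ≈⟨ Σ≤-suc l _ ⟩
    ⟦ l C 0 ⟧ * g 0 + Σ≤ l (λ j → ⟦ suc l C suc j ⟧ * g (suc j))
      ≈⟨ +-congˡ (trans (Σ≤-cong l (λ j _ → pascal j)) (Σ≤-+ l _ _)) ⟩
    ⟦ l C 0 ⟧ * g 0 + (Σ≤ l (λ j → ⟦ l C suc j ⟧ * g (suc j)) + Σ≤ l (λ j → ⟦ l C j ⟧ * g (suc j)))
      ≈⟨ +-assoc _ _ _ ⟨
    (⟦ l C 0 ⟧ * g 0 + Σ≤ l (λ j → ⟦ l C suc j ⟧ * g (suc j))) + Σ≤ l (λ j → ⟦ l C j ⟧ * g (suc j))
      ≈⟨ +-congʳ (binomial-sum-peel l g) ⟨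
    Σ≤ l (λ j → ⟦ l C j ⟧ * g j) + Σ≤ l (λ j → ⟦ l C j ⟧ * g (suc j))
      ∎
    where
    pascal : ∀ j → ⟦ suc l C suc j ⟧ * g (suc j) ≈ ⟦ l C suc j ⟧ * g (suc j) + ⟦ l C j ⟧ * g (suc j)
    pascal j = trans (*-congʳ (trans (reflexive (≡.cong ⟦_⟧ (≡.sym pascalℕ))) (⟦⟧-homo-+ (l C suc j) (l C j))))
                     (distribʳ _ _ _)
      where
      pascalℕ : l C suc j ℕ.+ l C j ≡ suc l C suc j
      pascalℕ = ≡.trans (ℕₚ.+-comm (l C suc j) (l C j)) (nCk+nC[k+1]≡[n+1]C[k+1] l j)

  sgn-alternation : ∀ k {u v w w′} → u * w ≈ v * w′ → u * (sgn (suc k) * w) + v * (sgn k * w′) ≈ 0#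
  sgn-alternation k {u} {v} {w} {w′} uw≈vw′ = begin
    u * (sgn (suc k) * w) + v * (sgn k * w′)  ≈⟨ +-cong (x∙yz≈y∙xz _ _ _) (x∙yz≈y∙xz _ _ _) ⟩
    sgn (suc k) * (u * w) + sgn k * (v * w′)  ≈⟨ +-congʳ (*-cong (-1*x≈-x (sgn k)) uw≈vw′) ⟩
    - sgn k * (v * w′) + sgn k * (v * w′)     ≈⟨ +-congʳ (-‿distribˡ-* _ _) ⟨
    - (sgn k * (v * w′)) + sgn k * (v * w′)   ≈⟨ -‿inverseˡ _ ⟩
    0#                                        ∎

  recurrence-unique : (F G : ℕ → ℕ → Carrier) →
    (∀ n → ⟦ suc n ⟧ * F 0 n ≈ ⟦ suc n ⟧ * G 0 n) →
    (∀ m n → ⟦ suc n ⟧ * F (suc m) n + ⟦ suc m ⟧ * F m (suc n)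
               ≈ ⟦ suc n ⟧ * G (suc m) n + ⟦ suc m ⟧ * G m (suc n)) →
    ∀ m n → F m n ≈ G m n
  recurrence-unique F G base step zero n = ⟦q⟧*-cancelˡ (suc n) (base n)
  recurrence-unique F G base step (suc m) n = ⟦q⟧*-cancelˡ (suc n) (+-cancelʳ _ _ _ (begin
    ⟦ suc n ⟧ * F (suc m) n + ⟦ suc m ⟧ * G m (suc n)
      ≈⟨ +-congˡ (*-congˡ (recurrence-unique F G base step m (suc n))) ⟨
    ⟦ suc n ⟧ * F (suc m) n + ⟦ suc m ⟧ * F m (suc n)  ≈⟨ step m n ⟩
    ⟦ suc n ⟧ * G (suc m) n + ⟦ suc m ⟧ * G m (suc n)  ∎))

  A-recurrence : ∀ a l t → A a (suc l) t + A (λ k → a (suc k)) l t ≈ t * A a l t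
  A-recurrence a l t = begin
    A a (suc l) t + A a′ l t
      ≈⟨ +-congʳ (trans (Σ≤-cong (suc l) (λ k _ → reassoc (suc l ∸ k))) (binomial-sum-pascal l g)) ⟩
    (Σ≤ l (λ k → ⟦ l C k ⟧ * g k) + Σ≤ l (λ k → ⟦ l C k ⟧ * g (suc k))) + A a′ l t
      ≈⟨ +-assoc _ _ _ ⟩
    Σ≤ l (λ k → ⟦ l C k ⟧ * g k) + (Σ≤ l (λ k → ⟦ l C k ⟧ * g (suc k)) + A a′ l t)
      ≈⟨ +-cong (sym (Σ≤-cong l raise)) (trans (sym (Σ≤-+ l _ _)) (Σ≤-≈0 l cancel)) ⟩
    Σ≤ l (λ k → t * (⟦ l C k ⟧ * sgn k * a k * pow t (l ∸ k))) + 0#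
      ≈⟨ +-identityʳ _ ⟩
    Σ≤ l (λ k → t * (⟦ l C k ⟧ * sgn k * a k * pow t (l ∸ k)))
      ≈⟨ Σ≤-*ˡ l t _ ⟨
    t * A a l t
      ∎
    where
    a′ : ℕ → Carrier
    a′ k = a (suc k)
    g : ℕ → Carrier
    g k = sgn k * (a k * pow t (suc l ∸ k))
    reassoc : ∀ {c s b} e → c * s * b * pow t e ≈ c * (s * (b * pow t e))
    reassoc e = trans (*-assoc _ _ _) (*-assoc _ _ _)
    raise : ∀ k → k ≤ l → t * (⟦ l C k ⟧ * sgn k * a k * pow t (l ∸ k)) ≈ ⟦ l C k ⟧ * g k
    raise k k≤l = begin
      t * (⟦ l C k ⟧ * sgn k * a k * pow t (l ∸ k))
        ≈⟨ rearrange _ _ _ _ _ ⟩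
      ⟦ l C k ⟧ * (sgn k * (a k * (t * pow t (l ∸ k))))
        ≡⟨ ≡.cong (λ e → ⟦ l C k ⟧ * (sgn k * (a k * pow t e))) (ℕₚ.+-∸-assoc 1 k≤l) ⟨
      ⟦ l C k ⟧ * g k
        ∎
      where
      rearrange : ∀ t c s b p → t * (c * s * b * p) ≈ c * (s * (b * (t * p)))
      rearrange = solve 5 (λ t c s b p → t :* (c :* s :* b :* p) := c :* (s :* (b :* (t :* p)))) refl
    cancel : ∀ k → ⟦ l C k ⟧ * g (suc k) + ⟦ l C k ⟧ * sgn k * a′ k * pow t (l ∸ k) ≈ 0#
    cancel k = trans (+-congˡ (reassoc (l ∸ k))) (sgn-alternation k refl)

  A-binomial : ∀ a l x y → A a l (x + y) ≈ Σ≤ l (λ j → ⟦ l C j ⟧ * (pow x j * A a (l ∸ j) y))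
  A-binomial a zero x y = sym (trans (*-congʳ ⟦1⟧≈1#) (trans (*-identityˡ _) (*-identityˡ _)))
  A-binomial a (suc l) x y = +-cancelʳ (A a′ l (x + y)) _ _ (begin
    A a (suc l) (x + y) + A a′ l (x + y)  ≈⟨ A-recurrence a l (x + y) ⟩
    (x + y) * A a l (x + y)               ≈⟨ *-congˡ (A-binomial a l x y) ⟩
    (x + y) * Σ≤ l (U a)                  ≈⟨ distribʳ _ _ _ ⟩
    x * Σ≤ l (U a) + y * Σ≤ l (U a)       ≈⟨ +-cong x-part y-part ⟨
    Σ≤ l (λ j → ⟦ l C j ⟧ * h (suc j)) + (Σ≤ l (λ j → ⟦ l C j ⟧ * h j) + Σ≤ l (U a′))
      ≈⟨ trans (sym (+-assoc _ _ _)) (+-congʳ (+-comm _ _)) ⟩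
    (Σ≤ l (λ j → ⟦ l C j ⟧ * h j) + Σ≤ l (λ j → ⟦ l C j ⟧ * h (suc j))) + Σ≤ l (U a′)
      ≈⟨ +-cong (binomial-sum-pascal l h) (A-binomial a′ l x y) ⟨
    Σ≤ (suc l) (λ j → ⟦ suc l C j ⟧ * h j) + A a′ l (x + y)
      ∎)
    where
    a′ : ℕ → Carrier
    a′ k = a (suc k)
    U : (ℕ → Carrier) → ℕ → Carrier
    U b j = ⟦ l C j ⟧ * (pow x j * A b (l ∸ j) y)
    h : ℕ → Carrier
    h j = pow x j * A a (suc l ∸ j) y
    x-part : Σ≤ l (λ j → ⟦ l C j ⟧ * h (suc j)) ≈ x * Σ≤ l (U a)
    x-part = trans (Σ≤-cong l (λ j _ → rearrange _ _ _ _)) (sym (Σ≤-*ˡ l x (U a)))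
      where
      rearrange : ∀ c x p b → c * ((x * p) * b) ≈ x * (c * (p * b))
      rearrange = solve 4 (λ c x p b → c :* ((x :* p) :* b) := x :* (c :* (p :* b))) refl
    y-part : Σ≤ l (λ j → ⟦ l C j ⟧ * h j) + Σ≤ l (U a′) ≈ y * Σ≤ l (U a)
    y-part = trans (sym (Σ≤-+ l _ _)) (trans (Σ≤-cong l step) (sym (Σ≤-*ˡ l y (U a))))
      where
      rearrange : ∀ c p b y → c * (p * (y * b)) ≈ y * (c * (p * b))
      rearrange = solve 4 (λ c p b y → c :* (p :* (y :* b)) := y :* (c :* (p :* b))) refl
      step : ∀ j → j ≤ l → ⟦ l C j ⟧ * h j + U a′ j ≈ y * U a j
      step j j≤l = begin
        ⟦ l C j ⟧ * (pow x j * A a (suc l ∸ j) y) + ⟦ l C j ⟧ * (pow x j * A a′ (l ∸ j) y)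
          ≡⟨ ≡.cong (λ e → ⟦ l C j ⟧ * (pow x j * A a e y) + U a′ j) (ℕₚ.+-∸-assoc 1 j≤l) ⟩
        ⟦ l C j ⟧ * (pow x j * A a (suc (l ∸ j)) y) + ⟦ l C j ⟧ * (pow x j * A a′ (l ∸ j) y)
          ≈⟨ trans (sym (distribˡ _ _ _)) (*-congˡ (sym (distribˡ _ _ _))) ⟩
        ⟦ l C j ⟧ * (pow x j * (A a (suc (l ∸ j)) y + A a′ (l ∸ j) y))
          ≈⟨ *-congˡ (*-congˡ (A-recurrence a (l ∸ j) y)) ⟩
        ⟦ l C j ⟧ * (pow x j * (y * A a (l ∸ j) y))
          ≈⟨ rearrange _ _ _ _ ⟩
        y * U a j
          ∎

  module _ (P : ℕ → Carrier → Carrier) (x y : Carrier)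
           (binomial : ∀ l → P l (x + y) ≈ Σ≤ l (λ j → ⟦ l C j ⟧ * (pow x j * P (l ∸ j) y))) where

    lhs-summand : ℕ → ℕ → ℕ → Carrier
    lhs-summand m n k = ⟦ n C k ⟧ * (pow x (m ℕ.+ k ℕ.+ 1) /ℕ (m ℕ.+ k ℕ.+ 1)) * P (n ∸ k) y

    lhs-sum : ℕ → ℕ → Carrier
    lhs-sum m n = Σ≤ n (lhs-summand m n)

    lhs-term : ℕ → ℕ → Carrier
    lhs-term m n = sgn m * (P (m ℕ.+ n ℕ.+ 1) y /ℕ ((m ℕ.+ n ℕ.+ 1) ℕ.* ((m ℕ.+ n) C n)))

    rhs-summand : ℕ → ℕ → ℕ → Carrier
    rhs-summand m n k = (⟦ m C k ⟧ /ℕ ((n ℕ.+ k) C k)) * sgn k * pow x (m ∸ k)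
                          * (P (n ℕ.+ k ℕ.+ 1) (x + y) /ℕ (n ℕ.+ k ℕ.+ 1))

    rhs : ℕ → ℕ → Carrier
    rhs m n = Σ≤ m (rhs-summand m n)

    binomial-tail : ℕ → Carrier
    binomial-tail n = Σ≤ n (λ k → ⟦ suc n C suc k ⟧ * (pow x (suc k) * P (n ∸ k) y))

    binomial-suc : ∀ n → P (suc n) (x + y) ≈ P (suc n) y + binomial-tail n
    binomial-suc n = trans (binomial (suc n)) (trans (Σ≤-suc n _)
      (+-congʳ (trans (*-congʳ ⟦1⟧≈1#) (trans (*-identityˡ _) (*-identityˡ _)))))

    lhs-sum-base : ∀ n → ⟦ suc n ⟧ * lhs-sum 0 n ≈ binomial-tail n
    lhs-sum-base n = trans (Σ≤-*ˡ n _ _) (Σ≤-cong n (λ k _ → summand k))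
      where
      summand : ∀ k → ⟦ suc n ⟧ * lhs-summand 0 n k ≈ ⟦ suc n C suc k ⟧ * (pow x (suc k) * P (n ∸ k) y)
      summand k = begin
        ⟦ suc n ⟧ * (⟦ n C k ⟧ * (pow x (k ℕ.+ 1) /ℕ (k ℕ.+ 1)) * P (n ∸ k) y)
          ≡⟨ ≡.cong (λ e → ⟦ suc n ⟧ * (⟦ n C k ⟧ * (pow x e /ℕ e) * P (n ∸ k) y)) (ℕₚ.+-comm k 1) ⟩
        ⟦ suc n ⟧ * (⟦ n C k ⟧ * (pow x (suc k) /ℕ suc k) * P (n ∸ k) y)
          ≈⟨ trans (sym (*-assoc _ _ _)) (*-congʳ (sym (*-assoc _ _ _))) ⟩
        ⟦ suc n ⟧ * ⟦ n C k ⟧ * (pow x (suc k) /ℕ suc k) * P (n ∸ k) y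
          ≈⟨ *-congʳ (*-congʳ (sym (⟦⟧-homo-* (suc n) (n C k)))) ⟩
        ⟦ suc n ℕ.* (n C k) ⟧ * (pow x (suc k) /ℕ suc k) * P (n ∸ k) y
          ≡⟨ ≡.cong (λ i → ⟦ i ⟧ * (pow x (suc k) /ℕ suc k) * P (n ∸ k) y)
                    ([1+k]*[1+n]C[1+k]≡[1+n]*nCk n k) ⟨
        ⟦ suc k ℕ.* (suc n C suc k) ⟧ * (pow x (suc k) /ℕ suc k) * P (n ∸ k) y
          ≈⟨ *-congʳ (⟦q*p⟧*[x/q]≈⟦p⟧*x (suc k) (suc n C suc k) (pow x (suc k))) ⟩
        ⟦ suc n C suc k ⟧ * pow x (suc k) * P (n ∸ k) y
          ≈⟨ *-assoc _ _ _ ⟩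
        ⟦ suc n C suc k ⟧ * (pow x (suc k) * P (n ∸ k) y)
          ∎

    lhs-sum-head : ∀ m n → ⟦ suc m ⟧ * lhs-summand m (suc n) 0 ≈ pow x (suc m) * P (suc n) y
    lhs-sum-head m n = begin
      ⟦ suc m ⟧ * (⟦ 1 ⟧ * (pow x (m ℕ.+ 0 ℕ.+ 1) /ℕ (m ℕ.+ 0 ℕ.+ 1)) * P (suc n) y)
        ≡⟨ ≡.cong (λ e → ⟦ suc m ⟧ * (⟦ 1 ⟧ * (pow x e /ℕ e) * P (suc n) y)) (n+0+1≡1+n m) ⟩
      ⟦ suc m ⟧ * (⟦ 1 ⟧ * (pow x (suc m) /ℕ suc m) * P (suc n) y)
        ≈⟨ *-congˡ (*-congʳ (trans (*-congʳ ⟦1⟧≈1#) (*-identityˡ _))) ⟩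
      ⟦ suc m ⟧ * ((pow x (suc m) /ℕ suc m) * P (suc n) y)
        ≈⟨ trans (sym (*-assoc _ _ _)) (*-congʳ (⟦q⟧*[x/q]≈x (suc m) _)) ⟩
      pow x (suc m) * P (suc n) y
        ∎

    lhs-sum-pair : ∀ m n k → ⟦ suc n ⟧ * lhs-summand (suc m) n k + ⟦ suc m ⟧ * lhs-summand m (suc n) (suc k)
                               ≈ pow x (suc m) * (⟦ suc n C suc k ⟧ * (pow x (suc k) * P (n ∸ k) y))
    lhs-sum-pair m n k = begin
      ⟦ suc n ⟧ * lhs-summand (suc m) n k + ⟦ suc m ⟧ * lhs-summand m (suc n) (suc k)
        ≡⟨ ≡.cong₂ (λ e e′ → ⟦ suc n ⟧ * (c * (pow x e /ℕ e) * B) + ⟦ suc m ⟧ * (c′ * (pow x e′ /ℕ e′) * B))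
                   e≡E e′≡E ⟩
      ⟦ suc n ⟧ * (c * J * B) + ⟦ suc m ⟧ * (c′ * J * B)
        ≈⟨ collect _ _ _ _ _ _ ⟩
      (⟦ suc n ⟧ * c + ⟦ suc m ⟧ * c′) * J * B
        ≈⟨ *-congʳ (*-congʳ (sym (trans (⟦⟧-homo-+ (suc n ℕ.* (n C k)) _)
             (+-cong (⟦⟧-homo-* (suc n) (n C k)) (⟦⟧-homo-* (suc m) (suc n C suc k)))))) ⟩
      ⟦ suc n ℕ.* (n C k) ℕ.+ suc m ℕ.* (suc n C suc k) ⟧ * J * B
        ≡⟨ ≡.cong (λ i → ⟦ i ⟧ * J * B) coefficient ⟩
      ⟦ E ℕ.* (suc n C suc k) ⟧ * J * B
        ≈⟨ *-congʳ (⟦q*p⟧*[x/q]≈⟦p⟧*x E (suc n C suc k) (pow x E)) ⟩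
      c′ * pow x E * B
        ≈⟨ *-congʳ (*-congˡ (pow-+ x (suc m) (suc k))) ⟩
      c′ * (pow x (suc m) * pow x (suc k)) * B
        ≈⟨ spread _ _ _ _ ⟩
      pow x (suc m) * (c′ * (pow x (suc k) * B))
        ∎
      where
      c = ⟦ n C k ⟧
      c′ = ⟦ suc n C suc k ⟧
      B = P (n ∸ k) y
      E = suc m ℕ.+ suc k
      J = pow x E /ℕ E
      e≡E : suc m ℕ.+ k ℕ.+ 1 ≡ E
      e≡E = ≡.trans (ℕₚ.+-assoc (suc m) k 1) (≡.cong (suc m ℕ.+_) (ℕₚ.+-comm k 1))
      e′≡E : m ℕ.+ suc k ℕ.+ 1 ≡ E
      e′≡E = ℕₚ.+-comm (m ℕ.+ suc k) 1
      coefficient : suc n ℕ.* (n C k) ℕ.+ suc m ℕ.* (suc n C suc k) ≡ E ℕ.* (suc n C suc k)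
      coefficient =
        ≡.trans (≡.cong (ℕ._+ suc m ℕ.* (suc n C suc k)) (≡.sym ([1+k]*[1+n]C[1+k]≡[1+n]*nCk n k)))
          (≡.trans (≡.sym (ℕₚ.*-distribʳ-+ (suc n C suc k) (suc k) (suc m)))
                   (≡.cong (ℕ._* (suc n C suc k)) (ℕₚ.+-comm (suc k) (suc m))))
      collect : ∀ u c v c′ j b → u * (c * j * b) + v * (c′ * j * b) ≈ (u * c + v * c′) * j * b
      collect = solve 6 (λ u c v c′ j b → u :* (c :* j :* b) :+ v :* (c′ :* j :* b)
                                          := (u :* c :+ v :* c′) :* j :* b) refl
      spread : ∀ c p p′ b → c * (p * p′) * b ≈ p * (c * (p′ * b))
      spread = solve 4 (λ c p p′ b → c :* (p :* p′) :* b := p :* (c :* (p′ :* b))) refl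

    lhs-sum-step : ∀ m n → ⟦ suc n ⟧ * lhs-sum (suc m) n + ⟦ suc m ⟧ * lhs-sum m (suc n)
                             ≈ pow x (suc m) * P (suc n) (x + y)
    lhs-sum-step m n = begin
      ⟦ suc n ⟧ * lhs-sum (suc m) n + ⟦ suc m ⟧ * lhs-sum m (suc n)
        ≈⟨ +-congˡ (trans (*-congˡ (Σ≤-suc n _)) (distribˡ _ _ _)) ⟩
      ⟦ suc n ⟧ * lhs-sum (suc m) n + (⟦ suc m ⟧ * lhs-summand m (suc n) 0 + ⟦ suc m ⟧ * Σ≤ n tail)
        ≈⟨ x+[y+z]≈y+[x+z] _ _ _ ⟩
      ⟦ suc m ⟧ * lhs-summand m (suc n) 0 + (⟦ suc n ⟧ * lhs-sum (suc m) n + ⟦ suc m ⟧ * Σ≤ n tail)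
        ≈⟨ +-cong (lhs-sum-head m n)
                  (trans (Σ≤-lincomb n _ _ _ _) (Σ≤-cong n (λ k _ → lhs-sum-pair m n k))) ⟩
      pow x (suc m) * P (suc n) y
        + Σ≤ n (λ k → pow x (suc m) * (⟦ suc n C suc k ⟧ * (pow x (suc k) * P (n ∸ k) y)))
        ≈⟨ +-congˡ (Σ≤-*ˡ n _ _) ⟨
      pow x (suc m) * P (suc n) y + pow x (suc m) * binomial-tail n
        ≈⟨ distribˡ _ _ _ ⟨
      pow x (suc m) * (P (suc n) y + binomial-tail n)
        ≈⟨ *-congˡ (binomial-suc n) ⟨
      pow x (suc m) * P (suc n) (x + y)
        ∎
      where
      tail : ℕ → Carrier
      tail k = lhs-summand m (suc n) (suc k)

    lhs-term-base : ∀ n → ⟦ suc n ⟧ * lhs-term 0 n ≈ P (suc n) y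
    lhs-term-base n = begin
      ⟦ suc n ⟧ * (1# * (P (n ℕ.+ 1) y /ℕ ((n ℕ.+ 1) ℕ.* (n C n))))
        ≈⟨ *-congˡ (*-identityˡ _) ⟩
      ⟦ suc n ⟧ * (P (n ℕ.+ 1) y /ℕ ((n ℕ.+ 1) ℕ.* (n C n)))
        ≡⟨ ≡.cong₂ (λ e d → ⟦ suc n ⟧ * (P e y /ℕ d)) (ℕₚ.+-comm n 1) denominator ⟩
      ⟦ suc n ⟧ * (P (suc n) y /ℕ suc n)
        ≈⟨ ⟦q⟧*[x/q]≈x (suc n) _ ⟩
      P (suc n) y
        ∎
      where
      denominator : (n ℕ.+ 1) ℕ.* (n C n) ≡ suc n
      denominator = ≡.trans (≡.cong₂ ℕ._*_ (ℕₚ.+-comm n 1) (nCn≡1 n)) (ℕₚ.*-identityʳ (suc n))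

    lhs-term-step : ∀ m n → ⟦ suc n ⟧ * lhs-term (suc m) n + ⟦ suc m ⟧ * lhs-term m (suc n) ≈ 0#
    lhs-term-step m n = begin
      ⟦ suc n ⟧ * lhs-term (suc m) n + ⟦ suc m ⟧ * lhs-term m (suc n)
        ≡⟨ ≡.cong (λ j → ⟦ suc n ⟧ * lhs-term (suc m) n + ⟦ suc m ⟧ * (sgn m * T j)) (ℕₚ.+-suc m n) ⟩
      ⟦ suc n ⟧ * (sgn (suc m) * (P E y /ℕ (E ℕ.* (M C n)))) + ⟦ suc m ⟧ * (sgn m * T M)
        ≈⟨ sgn-alternation m (⟦p⟧*[x/q]≈⟦p′⟧*[x/q′] (suc n) (E ℕ.* (M C n)) (suc m) (E ℕ.* (M C suc n))
                                                    (P E y) cross) ⟩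
      0#
        ∎
      where
      M = suc (m ℕ.+ n)
      E = M ℕ.+ 1
      T : ℕ → Carrier
      T j = P (j ℕ.+ 1) y /ℕ ((j ℕ.+ 1) ℕ.* (j C suc n))
      instance
        E*MCn≢0 : NonZero (E ℕ.* (M C n))
        E*MCn≢0 = ℕₚ.m*n≢0 E (M C n) {{_}} {{nCk≢0 (ℕₚ.m≤n+m n (suc m))}}
        E*MC[1+n]≢0 : NonZero (E ℕ.* (M C suc n))
        E*MC[1+n]≢0 = ℕₚ.m*n≢0 E (M C suc n) {{_}} {{nCk≢0 (s≤s (ℕₚ.m≤n+m n m))}}
      cross : suc n ℕ.* (E ℕ.* (M C suc n)) ≡ suc m ℕ.* (E ℕ.* (M C n))
      cross = ≡.trans (ℕ-x∙yz≈y∙xz (suc n) E _)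
        (≡.trans (≡.cong (E ℕ.*_) ([1+k]*[1+p+k]C[1+k]≡[1+p]*[1+p+k]Ck m n)) (ℕ-x∙yz≈y∙xz E (suc m) _))

    rhs-head : ∀ m n → ⟦ suc n ⟧ * rhs-summand m n 0 ≈ pow x m * P (suc n) (x + y)
    rhs-head m n = begin
      ⟦ suc n ⟧ * ((⟦ 1 ⟧ /ℕ 1) * 1# * pow x m * (P (n ℕ.+ 0 ℕ.+ 1) (x + y) /ℕ (n ℕ.+ 0 ℕ.+ 1)))
        ≡⟨ ≡.cong (λ e → ⟦ suc n ⟧ * ((⟦ 1 ⟧ /ℕ 1) * 1# * pow x m * (P e (x + y) /ℕ e)))
                  (n+0+1≡1+n n) ⟩
      ⟦ suc n ⟧ * ((⟦ 1 ⟧ /ℕ 1) * 1# * pow x m * (P (suc n) (x + y) /ℕ suc n))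
        ≈⟨ *-congˡ (*-congʳ (trans (*-congʳ (trans (*-identityʳ _) (inv-correct 0))) (*-identityˡ _))) ⟩
      ⟦ suc n ⟧ * (pow x m * (P (suc n) (x + y) /ℕ suc n))
        ≈⟨ x∙yz≈y∙xz _ _ _ ⟩
      pow x m * (⟦ suc n ⟧ * (P (suc n) (x + y) /ℕ suc n))
        ≈⟨ *-congˡ (⟦q⟧*[x/q]≈x (suc n) _) ⟩
      pow x m * P (suc n) (x + y)
        ∎

    rhs-base : ∀ n → ⟦ suc n ⟧ * rhs 0 n ≈ P (suc n) (x + y)
    rhs-base n = trans (rhs-head 0 n) (*-identityˡ _)

    rhs-pair : ∀ m n k →
               ⟦ suc n ⟧ * rhs-summand (suc m) n (suc k) + ⟦ suc m ⟧ * rhs-summand m (suc n) k ≈ 0#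
    rhs-pair m n k = begin
      ⟦ suc n ⟧ * rhs-summand (suc m) n (suc k) + ⟦ suc m ⟧ * rhs-summand m (suc n) k
        ≡⟨ ≡.cong (λ j → ⟦ suc n ⟧ * (c₁ j * sgn (suc k) * pow x (m ∸ k) * W j)
                           + ⟦ suc m ⟧ * rhs-summand m (suc n) k)
                  (ℕₚ.+-suc n k) ⟩
      ⟦ suc n ⟧ * (c₁ N * sgn (suc k) * pow x (m ∸ k) * W N)
        + ⟦ suc m ⟧ * (c₂ * sgn k * pow x (m ∸ k) * W N)
        ≈⟨ +-cong (*-congˡ (sign-first _ _ _ _)) (*-congˡ (sign-first _ _ _ _)) ⟩
      ⟦ suc n ⟧ * (sgn (suc k) * (c₁ N * (pow x (m ∸ k) * W N)))
        + ⟦ suc m ⟧ * (sgn k * (c₂ * (pow x (m ∸ k) * W N)))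
        ≈⟨ sgn-alternation k (trans (sym (*-assoc _ _ _)) (trans (*-congʳ coefficient) (*-assoc _ _ _))) ⟩
      0#
        ∎
      where
      N = suc (n ℕ.+ k)
      c₁ : ℕ → Carrier
      c₁ j = ⟦ suc m C suc k ⟧ /ℕ (j C suc k)
      c₂ = ⟦ m C k ⟧ /ℕ (N C k)
      W : ℕ → Carrier
      W j = P (j ℕ.+ 1) (x + y) /ℕ (j ℕ.+ 1)
      sign-first : ∀ c s p w → c * s * p * w ≈ s * (c * (p * w))
      sign-first = solve 4 (λ c s p w → c :* s :* p :* w := s :* (c :* (p :* w))) refl
      cross : (suc n ℕ.* (suc m C suc k)) ℕ.* (N C k) ≡ (suc m ℕ.* (m C k)) ℕ.* (N C suc k)
      cross = ≡.trans (ℕ-xy∙z≈y∙xz (suc n) (suc m C suc k) (N C k))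
        (≡.trans (≡.cong ((suc m C suc k) ℕ.*_) (≡.sym ([1+k]*[1+p+k]C[1+k]≡[1+p]*[1+p+k]Ck n k)))
        (≡.trans (≡.sym (ℕ-xy∙z≈y∙xz (suc k) (suc m C suc k) (N C suc k)))
                 (≡.cong (ℕ._* (N C suc k)) ([1+k]*[1+n]C[1+k]≡[1+n]*nCk m k))))
      coefficient : ⟦ suc n ⟧ * c₁ N ≈ ⟦ suc m ⟧ * c₂
      coefficient = begin
        ⟦ suc n ⟧ * (⟦ suc m C suc k ⟧ /ℕ (N C suc k))
          ≈⟨ *-congˡ (x/q≈x*[1/q] (N C suc k) _) ⟩
        ⟦ suc n ⟧ * (⟦ suc m C suc k ⟧ * (1# /ℕ (N C suc k)))
          ≈⟨ trans (sym (*-assoc _ _ _)) (*-congʳ (sym (⟦⟧-homo-* (suc n) (suc m C suc k)))) ⟩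
        ⟦ suc n ℕ.* (suc m C suc k) ⟧ * (1# /ℕ (N C suc k))
          ≈⟨ ⟦p⟧*[x/q]≈⟦p′⟧*[x/q′] (suc n ℕ.* (suc m C suc k)) (N C suc k) (suc m ℕ.* (m C k)) (N C k)
               {{nCk≢0 (s≤s (ℕₚ.m≤n+m k n))}} {{nCk≢0 (ℕₚ.m≤n+m k (suc n))}} 1# cross ⟩
        ⟦ suc m ℕ.* (m C k) ⟧ * (1# /ℕ (N C k))
          ≈⟨ trans (*-congʳ (⟦⟧-homo-* (suc m) (m C k))) (*-assoc _ _ _) ⟩
        ⟦ suc m ⟧ * (⟦ m C k ⟧ * (1# /ℕ (N C k)))
          ≈⟨ *-congˡ (x/q≈x*[1/q] (N C k) _) ⟨
        ⟦ suc m ⟧ * (⟦ m C k ⟧ /ℕ (N C k))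
          ∎

    rhs-step : ∀ m n → ⟦ suc n ⟧ * rhs (suc m) n + ⟦ suc m ⟧ * rhs m (suc n)
                         ≈ pow x (suc m) * P (suc n) (x + y)
    rhs-step m n = begin
      ⟦ suc n ⟧ * rhs (suc m) n + ⟦ suc m ⟧ * rhs m (suc n)
        ≈⟨ +-congʳ (trans (*-congˡ (Σ≤-suc m _)) (distribˡ _ _ _)) ⟩
      (⟦ suc n ⟧ * rhs-summand (suc m) n 0 + ⟦ suc n ⟧ * Σ≤ m (λ k → rhs-summand (suc m) n (suc k)))
        + ⟦ suc m ⟧ * rhs m (suc n)
        ≈⟨ +-assoc _ _ _ ⟩
      ⟦ suc n ⟧ * rhs-summand (suc m) n 0
        + (⟦ suc n ⟧ * Σ≤ m (λ k → rhs-summand (suc m) n (suc k)) + ⟦ suc m ⟧ * rhs m (suc n))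
        ≈⟨ +-cong (rhs-head (suc m) n) (trans (Σ≤-lincomb m _ _ _ _) (Σ≤-≈0 m (rhs-pair m n))) ⟩
      pow x (suc m) * P (suc n) (x + y) + 0#
        ≈⟨ +-identityʳ _ ⟩
      pow x (suc m) * P (suc n) (x + y)
        ∎

    lhs≈rhs : ∀ m n → lhs-sum m n + lhs-term m n ≈ rhs m n
    lhs≈rhs = recurrence-unique (λ m n → lhs-sum m n + lhs-term m n) rhs base step
      where
      base : ∀ n → ⟦ suc n ⟧ * (lhs-sum 0 n + lhs-term 0 n) ≈ ⟦ suc n ⟧ * rhs 0 n
      base n = begin
        ⟦ suc n ⟧ * (lhs-sum 0 n + lhs-term 0 n)              ≈⟨ distribˡ _ _ _ ⟩
        ⟦ suc n ⟧ * lhs-sum 0 n + ⟦ suc n ⟧ * lhs-term 0 n  ≈⟨ +-cong (lhs-sum-base n) (lhs-term-base n) ⟩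
        binomial-tail n + P (suc n) y                         ≈⟨ +-comm _ _ ⟩
        P (suc n) y + binomial-tail n                         ≈⟨ binomial-suc n ⟨
        P (suc n) (x + y)                                     ≈⟨ rhs-base n ⟨
        ⟦ suc n ⟧ * rhs 0 n                                   ∎
      step : ∀ m n → ⟦ suc n ⟧ * (lhs-sum (suc m) n + lhs-term (suc m) n)
                       + ⟦ suc m ⟧ * (lhs-sum m (suc n) + lhs-term m (suc n))
                       ≈ ⟦ suc n ⟧ * rhs (suc m) n + ⟦ suc m ⟧ * rhs m (suc n)
      step m n = begin
        ⟦ suc n ⟧ * (lhs-sum (suc m) n + lhs-term (suc m) n)
          + ⟦ suc m ⟧ * (lhs-sum m (suc n) + lhs-term m (suc n))
          ≈⟨ trans (+-cong (distribˡ _ _ _) (distribˡ _ _ _)) (+-interchange _ _ _ _) ⟩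
        (⟦ suc n ⟧ * lhs-sum (suc m) n + ⟦ suc m ⟧ * lhs-sum m (suc n))
          + (⟦ suc n ⟧ * lhs-term (suc m) n + ⟦ suc m ⟧ * lhs-term m (suc n))
          ≈⟨ +-cong (lhs-sum-step m n) (lhs-term-step m n) ⟩
        pow x (suc m) * P (suc n) (x + y) + 0#
          ≈⟨ +-identityʳ _ ⟩
        pow x (suc m) * P (suc n) (x + y)
          ≈⟨ rhs-step m n ⟨
        ⟦ suc n ⟧ * rhs (suc m) n + ⟦ suc m ⟧ * rhs m (suc n)
          ∎

lemma2 : {c ℓ : Level} (R : QAlgebra c ℓ) → let open QAlgebra R in let open Ops R in
    (a : ℕ → Carrier) (m n : ℕ) (x y : Carrier) →
      Σ≤ n (λ k → ⟦ n C k ⟧ * (pow x (m ℕ.+ k ℕ.+ 1) /ℕ (m ℕ.+ k ℕ.+ 1)) * A a (n ∸ k) y)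
        + sgn m * (A a (m ℕ.+ n ℕ.+ 1) y /ℕ ((m ℕ.+ n ℕ.+ 1) ℕ.* ((m ℕ.+ n) C n)))
      ≈ Σ≤ m (λ k → (⟦ m C k ⟧ /ℕ ((n ℕ.+ k) C k)) * sgn k * pow x (m ∸ k)
                      * (A a (n ℕ.+ k ℕ.+ 1) (x + y) /ℕ (n ℕ.+ k ℕ.+ 1)))
lemma2 R a m n x y = lhs≈rhs R (A a) x y (λ l → A-binomial R a l x y) m n
  where open Ops R
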